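{- Let $q$ be a prime power and $k,m$ positive integers. Let $W_1,W_2$ be $\mathbb{F}_{q^m}$-subspaces of $\mathbb{F}_{q^m}^k$ with $W_1\oplus W_2=\mathbb{F}_{q^m}^k$, and let $U_1\subseteq W_1$, $U_2\subseteq W_2$ be $\mathbb{F}_q$-subspaces of dimensions $n_1,n_2$ respectively. Suppose $L_{U_1}$ is an $i$-club and $L_{U_2}$ is a scattered $\mathbb{F}_q$-linear set. Then, with $U=U_1\oplus U_2$, $L_U$ is an $i$-club of rank $n_1+n_2$ in $\mathrm{PG}(k-1,q^m)$.
   Context: $L_U=\{\langle u\rangle_{\mathbb{F}_{q^m}} : u\in U\setminus\{0\}\}$ has rank $\dim_{\mathbb{F}_q}U$; the weight of a point $\langle v\rangle_{\mathbb{F}_{q^m}}$ is $\dim_{\mathbb{F}_q}(U\cap\langle v\rangle_{\mathbb{F}_{q^m}})$; $L_U$ is scattered if all its points have weight $1$, and is an $i$-club if exactly one point of $L_U$ has weight $i$ and all others weight $1$. -}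

module Defs where

open import Level using (0ℓ)
open import Data.Nat using (ℕ; zero; suc; _≤_; _^_)
open import Data.Unit using (⊤)
open import Data.Nat.Primality using (Prime)
open import Data.Fin using (Fin; zero; suc)
open import Data.Product using (Σ; ∃; ∃-syntax; _×_; _,_)
open import Relation.Nullary using (¬_)
open import Relation.Binary.PropositionalEquality using (_≡_)
open import Algebra.Bundles using (CommutativeRing)

IsPrimePower : ℕ → Set
IsPrimePower q = ∃[ p ] ∃[ e ] (Prime p × 1 ≤ e × q ≡ p ^ e)

module _ (F : CommutativeRing 0ℓ 0ℓ) where
  open CommutativeRing F using (Carrier; _≈_; _+_; _*_; -_; 0#; 1#)

  IsField : Set
  IsField = (¬ (1# ≈ 0#)) × (∀ a → ¬ (a ≈ 0#) → ∃[ b ] (a * b ≈ 1#))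

  SubsetHasCard : (Carrier → Set) → ℕ → Set
  SubsetHasCard S n =
    Σ (Fin n → Carrier) λ e →
      (∀ j → S (e j)) ×
      (∀ j j' → e j ≈ e j' → j ≡ j') ×
      (∀ a → S a → ∃[ j ] (e j ≈ a))

  HasCard : ℕ → Set
  HasCard n = Σ (Fin n → Carrier) λ e →
      (∀ j j' → e j ≈ e j' → j ≡ j') × (∀ a → ∃[ j ] (e j ≈ a))

  IsSubfield : (Carrier → Set) → Set
  IsSubfield K =
    (∀ a b → a ≈ b → K a → K b) ×
    K 0# × K 1# ×
    (∀ a b → K a → K b → K (a + b)) ×
    (∀ a b → K a → K b → K (a * b)) ×
    (∀ a → K a → K (- a)) ×
    (∀ a → K a → ¬ (a ≈ 0#) → ∃[ b ] (K b × a * b ≈ 1#))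

  module _ (k : ℕ) where
    Vec : Set
    Vec = Fin k → Carrier

    _≈v_ : Vec → Vec → Set
    u ≈v v = ∀ j → u j ≈ v j

    0v : Vec
    0v _ = 0#

    _+v_ : Vec → Vec → Vec
    (u +v v) j = u j + v j

    _·v_ : Carrier → Vec → Vec
    (a ·v v) j = a * v j

    sumv : ∀ n → (Fin n → Vec) → Vec
    sumv zero b = 0v
    sumv (suc n) b = b zero +v sumv n (λ j → b (suc j))

    -- V is a subspace over the scalars S (S = F or S = K)
    IsSubspaceOver : (Carrier → Set) → (Vec → Set) → Set
    IsSubspaceOver S V =
      (∀ u v → u ≈v v → V u → V v) ×
      V 0v ×
      (∀ u v → V u → V v → V (u +v v)) ×
      (∀ a v → S a → V v → V (a ·v v))

    IsFSubspace : (Vec → Set) → Set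
    IsFSubspace = IsSubspaceOver (λ _ → ⊤)

    _⊆v_ : (Vec → Set) → (Vec → Set) → Set
    V ⊆v W = ∀ v → V v → W v

    DirectSumWhole : (Vec → Set) → (Vec → Set) → Set
    DirectSumWhole W₁ W₂ =
      (∀ v → W₁ v → W₂ v → v ≈v 0v) ×
      (∀ v → ∃[ w₁ ] ∃[ w₂ ] (W₁ w₁ × W₂ w₂ × v ≈v (w₁ +v w₂)))

    SumSpace : (Vec → Set) → (Vec → Set) → (Vec → Set)
    SumSpace U₁ U₂ v = ∃[ u₁ ] ∃[ u₂ ] (U₁ u₁ × U₂ u₂ × v ≈v (u₁ +v u₂))

    FSpan : Vec → (Vec → Set)
    FSpan v x = ∃[ a ] (x ≈v (a ·v v))

    Nonzero : Vec → Set
    Nonzero v = ¬ (v ≈v 0v)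

    module _ (K : Carrier → Set) where
      KCombination : ∀ n → (Fin n → Vec) → Vec → Set
      KCombination n b v =
        Σ (Fin n → Carrier) λ c → ((∀ j → K (c j)) × v ≈v sumv n (λ j → c j ·v b j))

      KLinIndep : ∀ n → (Fin n → Vec) → Set
      KLinIndep n b = ∀ (c : Fin n → Carrier) → (∀ j → K (c j)) →
        sumv n (λ j → c j ·v b j) ≈v 0v → ∀ j → c j ≈ 0#

      HasDimK : (Vec → Set) → ℕ → Set
      HasDimK V n = Σ (Fin n → Vec) λ b →
        (∀ j → V (b j)) × KLinIndep n b × (∀ v → V v → KCombination n b v)

      -- the point ⟨v⟩_F has weight w in L_U : dim_K (U ∩ ⟨v⟩_F) = w
      HasWeight : (Vec → Set) → Vec → ℕ → Set
      HasWeight U v w = HasDimK (λ x → U x × FSpan v x) w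

      IsScattered : (Vec → Set) → Set
      IsScattered U = ∀ u → U u → Nonzero u → HasWeight U u 1

      IsClub : (Vec → Set) → ℕ → Set
      IsClub U i = ∃[ u ] (U u × Nonzero u × HasWeight U u i ×
        (∀ u' → U u' → Nonzero u' → ¬ FSpan u u' → HasWeight U u' 1))

-- Since W₁ ∩ W₂ = 0, every vector of U = U₁ ⊕ U₂ splits uniquely as x₁ + x₂ with xᵢ ∈ Wᵢ.
-- Hence concatenated bases of U₁ and U₂ form a basis of U, and a x ∈ U exactly when
-- a x₁ ∈ U₁ and a x₂ ∈ U₂. A point ⟨x⟩ of L_U has weight one iff every a with a x ∈ U
-- lies in 𝔽_q. If x₂ ≠ 0 this holds because L_{U₂} is scattered at ⟨x₂⟩; if x₂ = 0 then
-- ⟨x⟩ = ⟨x₁⟩ is a point of L_{U₁} other than the club's head, so it has weight one there.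
-- The head ⟨u⟩ lies in W₁, where U meets it exactly in U₁ ∩ ⟨u⟩, so it keeps weight i.
module Submission where

open import Defs
open import Level using (0ℓ)
open import Data.Nat using (ℕ; zero; suc; _≤_; _^_)
import Data.Nat as ℕ
open import Data.Fin using (Fin; zero; suc; _↑ˡ_; _↑ʳ_; splitAt)
import Data.Fin.Properties as Fin
open import Data.Vec.Functional using (_++_; take; drop)
open import Data.Vec.Functional.Properties using (lookup-++ˡ; lookup-++ʳ)
open import Data.Vec.Functional.Relation.Unary.All using (All)
import Data.Vec.Functional.Relation.Unary.All.Properties as All
open import Data.Product using (∃-syntax; _×_; _,_; proj₁; proj₂)
open import Data.Sum using (inj₁; inj₂)
open import Data.Unit using (tt)
open import Function using (_∘_)
open import Relation.Nullary using (¬_; yes; no; contradiction)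
open import Relation.Nullary.Decidable using (map′)
open import Relation.Binary.Definitions using (Decidable)
import Relation.Binary.PropositionalEquality as ≡
open import Algebra.Bundles using (CommutativeRing)

HasCard⇒≈-decidable : (F : CommutativeRing 0ℓ 0ℓ) {N : ℕ} →
  HasCard F N → Decidable (CommutativeRing._≈_ F)
HasCard⇒≈-decidable F (e , e-injective , e-surjective) a b
  with e-surjective a | e-surjective b
... | i , eᵢ≈a | j , eⱼ≈b =
  map′ (λ { ≡.refl → trans (sym eᵢ≈a) eⱼ≈b })
       (λ a≈b → e-injective i j (trans eᵢ≈a (trans a≈b (sym eⱼ≈b))))
       (i Fin.≟ j)
  where open CommutativeRing F

↑-elim : ∀ m {n} {P : Fin (m ℕ.+ n) → Set} →
  (∀ i → P (i ↑ˡ n)) → (∀ j → P (m ↑ʳ j)) → ∀ i → P i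
↑-elim m {P = P} Pˡ Pʳ i with splitAt m i in eq
... | inj₁ j = ≡.subst P (Fin.splitAt⁻¹-↑ˡ eq) (Pˡ j)
... | inj₂ j = ≡.subst P (Fin.splitAt⁻¹-↑ʳ eq) (Pʳ j)

module Coordinates (F : CommutativeRing 0ℓ 0ℓ) (k : ℕ) where
  open CommutativeRing F hiding (zero)
  open import Algebra.Properties.Ring ring using (-1*x≈-x; [y-z]x≈yx-zx)
  open import Algebra.Properties.Group +-group
    using (x∙y⁻¹≈ε⇒x≈y; x≈y⇒x∙y⁻¹≈ε; inverseˡ-unique)
  open import Algebra.Properties.AbelianGroup +-abelianGroup
    using (⁻¹-anti-homo‿-; ⁻¹-∙-comm)
  open import Algebra.Properties.CommutativeSemigroup +-commutativeSemigroup
    using (interchange)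
  open import Relation.Binary.Reasoning.Setoid setoid
  open import Data.Vec.Functional.Relation.Binary.Equality.Setoid setoid public
    using (_≋_; ≋-refl; ≋-reflexive; ≋-sym; ≋-trans)

  V : Set
  V = Vec F k

  infixl 6 _⊕_ _⊖_
  infixr 7 _•_

  _⊕_ : V → V → V
  _⊕_ = _+v_ F k

  _•_ : Carrier → V → V
  _•_ = _·v_ F k

  𝟎 : V
  𝟎 = 0v F k

  -- Subtraction through the scalar -1, under which subspaces are closed by definition.
  _⊖_ : V → V → V
  u ⊖ v = u ⊕ - 1# • v

  combination : ∀ {n} → (Fin n → Carrier) → (Fin n → V) → V
  combination {n} c b = sumv F k n (λ j → c j • b j)

  +-transpose : ∀ {x y z w} → x + y ≈ z + w → x - z ≈ w - y
  +-transpose {x} {y} {z} {w} eq = begin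
    x - z      ≈⟨ inverseˡ-unique (x - z) (y - w) sum≈0 ⟩
    - (y - w)  ≈⟨ ⁻¹-anti-homo‿- y w ⟩
    w - y      ∎
    where
    sum≈0 : (x - z) + (y - w) ≈ 0#
    sum≈0 = begin
      (x - z) + (y - w)      ≈⟨ interchange x (- z) y (- w) ⟩
      (x + y) + (- z + - w)  ≈⟨ +-congˡ (⁻¹-∙-comm z w) ⟩
      (x + y) - (z + w)      ≈⟨ x≈y⇒x∙y⁻¹≈ε eq ⟩
      0#                     ∎

  x*y≈1⇒x*z≈0⇒z≈0 : ∀ {x y z} → x * y ≈ 1# → x * z ≈ 0# → z ≈ 0#
  x*y≈1⇒x*z≈0⇒z≈0 {x} {y} {z} xy≈1 xz≈0 = begin
    z             ≈⟨ *-identityˡ z ⟨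
    1# * z        ≈⟨ *-congʳ (trans (*-comm y x) xy≈1) ⟨
    (y * x) * z   ≈⟨ *-assoc y x z ⟩
    y * (x * z)   ≈⟨ *-congˡ xz≈0 ⟩
    y * 0#        ≈⟨ zeroʳ y ⟩
    0#            ∎

  ⊕-transpose : ∀ {p₁ p₂ q₁ q₂} → p₁ ⊕ p₂ ≋ q₁ ⊕ q₂ → p₁ ⊖ q₁ ≋ q₂ ⊖ p₂
  ⊕-transpose {p₁} {p₂} {q₁} {q₂} eq j = begin
    p₁ j + - 1# * q₁ j  ≈⟨ +-congˡ (-1*x≈-x (q₁ j)) ⟩
    p₁ j - q₁ j         ≈⟨ +-transpose (eq j) ⟩
    q₂ j - p₂ j         ≈⟨ +-congˡ (-1*x≈-x (p₂ j)) ⟨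
    q₂ j + - 1# * p₂ j  ∎

  ⊖≋𝟎⇒≋ : ∀ {u v} → u ⊖ v ≋ 𝟎 → u ≋ v
  ⊖≋𝟎⇒≋ {u} {v} eq j = x∙y⁻¹≈ε⇒x≈y (u j) (v j) (trans (+-congˡ (sym (-1*x≈-x (v j)))) (eq j))

  ⊕-identityʳ : ∀ v → v ⊕ 𝟎 ≋ v
  ⊕-identityʳ v j = +-identityʳ (v j)

  ⊕-cong : ∀ {u u' v v'} → u ≋ u' → v ≋ v' → u ⊕ v ≋ u' ⊕ v'
  ⊕-cong u≋u' v≋v' j = +-cong (u≋u' j) (v≋v' j)

  •-identityˡ : ∀ v → 1# • v ≋ v
  •-identityˡ v j = *-identityˡ (v j)

  •-distribˡ : ∀ a u v → a • (u ⊕ v) ≋ a • u ⊕ a • v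
  •-distribˡ a u v j = distribˡ a (u j) (v j)

  •-congˡ : ∀ a {u v} → u ≋ v → a • u ≋ a • v
  •-congˡ a eq j = *-congˡ (eq j)

  ≈0⇒•≋𝟎 : ∀ {a} v → a ≈ 0# → a • v ≋ 𝟎
  ≈0⇒•≋𝟎 v a≈0 j = trans (*-congʳ a≈0) (zeroˡ (v j))

  •-invert : ∀ {c c' b v} → c * c' ≈ 1# → v ≋ c • b → b ≋ c' • v
  •-invert {c} {c'} {b} {v} cc'≈1 v≋cb j = begin
    b j                ≈⟨ *-identityˡ (b j) ⟨
    1# * b j           ≈⟨ *-congʳ (trans (*-comm c' c) cc'≈1) ⟨
    (c' * c) * b j     ≈⟨ *-assoc c' c (b j) ⟩
    c' * (c * b j)     ≈⟨ *-congˡ (v≋cb j) ⟨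
    c' * v j           ∎

  •-assoc : ∀ a b v → a • b • v ≋ (a * b) • v
  •-assoc a b v j = sym (*-assoc a b (v j))

  sumv-cong : ∀ n {f g : Fin n → V} → (∀ j → f j ≋ g j) → sumv F k n f ≋ sumv F k n g
  sumv-cong zero     f≋g = ≋-refl
  sumv-cong (suc n) f≋g j = +-cong (f≋g zero j) (sumv-cong n (f≋g ∘ suc) j)

  sumv-↑ : ∀ m n (f : Fin (m ℕ.+ n) → V) →
    sumv F k (m ℕ.+ n) f ≋ sumv F k m (f ∘ (_↑ˡ n)) ⊕ sumv F k n (f ∘ (m ↑ʳ_))
  sumv-↑ zero    n f j = sym (+-identityˡ _)
  sumv-↑ (suc m) n f j =
    trans (+-congˡ (sumv-↑ m n (f ∘ suc) j)) (sym (+-assoc _ _ _))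

  combination-cong : ∀ {n} {c c' : Fin n → Carrier} {b b' : Fin n → V} →
    (∀ j → c j ≈ c' j) → (∀ j → b j ≋ b' j) → combination c b ≋ combination c' b'
  combination-cong {n} c≈c' b≋b' = sumv-cong n (λ j i → *-cong (c≈c' j) (b≋b' j i))

  combination₁ : ∀ (c : Fin 1 → Carrier) b → combination c b ≋ c zero • b zero
  combination₁ c b = ⊕-identityʳ (c zero • b zero)

  combination-++ : ∀ {m n} (c : Fin (m ℕ.+ n) → Carrier) (b₁ : Fin m → V) (b₂ : Fin n → V) →
    combination c (b₁ ++ b₂) ≋ combination (take m c) b₁ ⊕ combination (drop m c) b₂
  combination-++ {m} {n} c b₁ b₂ j = trans (sumv-↑ m n _ j) (+-cong
    (combination-cong (λ _ → refl) (≋-reflexive ∘ lookup-++ˡ b₁ b₂) j)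
    (combination-cong (λ _ → refl) (≋-reflexive ∘ lookup-++ʳ b₁ b₂) j))

  combination-++-++ : ∀ {m n} (c₁ : Fin m → Carrier) (c₂ : Fin n → Carrier) b₁ b₂ →
    combination (c₁ ++ c₂) (b₁ ++ b₂) ≋ combination c₁ b₁ ⊕ combination c₂ b₂
  combination-++-++ c₁ c₂ b₁ b₂ j = trans (combination-++ (c₁ ++ c₂) b₁ b₂ j) (+-cong
    (combination-cong (reflexive ∘ lookup-++ˡ c₁ c₂) (λ _ → ≋-refl) j)
    (combination-cong (reflexive ∘ lookup-++ʳ c₁ c₂) (λ _ → ≋-refl) j))

  module _ {S : Carrier → Set} {U : V → Set} where

    ∈-resp : IsSubspaceOver F k S U → ∀ {u v} → u ≋ v → U u → U v
    ∈-resp (resp , _) = resp _ _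

    𝟎-∈ : IsSubspaceOver F k S U → U 𝟎
    𝟎-∈ (_ , 𝟎∈U , _) = 𝟎∈U

    ⊕-∈ : IsSubspaceOver F k S U → ∀ {u v} → U u → U v → U (u ⊕ v)
    ⊕-∈ (_ , _ , ⊕-closed , _) = ⊕-closed _ _

    •-∈ : IsSubspaceOver F k S U → ∀ {a v} → S a → U v → U (a • v)
    •-∈ (_ , _ , _ , •-closed) = •-closed _ _

    ⊖-∈ : IsSubspaceOver F k S U → S (- 1#) → ∀ {u v} → U u → U v → U (u ⊖ v)
    ⊖-∈ U-subspace S-1 u∈U v∈U = ⊕-∈ U-subspace u∈U (•-∈ U-subspace S-1 v∈U)

    combination-∈ : IsSubspaceOver F k S U → ∀ n {c : Fin n → Carrier} {b : Fin n → V} →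
      All S c → All U b → U (combination c b)
    combination-∈ U-subspace zero    c∈S b∈U = 𝟎-∈ U-subspace
    combination-∈ U-subspace (suc n) c∈S b∈U = ⊕-∈ U-subspace
      (•-∈ U-subspace (c∈S zero) (b∈U zero))
      (combination-∈ U-subspace n (c∈S ∘ suc) (b∈U ∘ suc))

  module _ {W₁ W₂ : V → Set}
           (W₁-subspace : IsFSubspace F k W₁) (W₂-subspace : IsFSubspace F k W₂)
           (W₁∩W₂≋𝟎 : ∀ v → W₁ v → W₂ v → v ≋ 𝟎) where

    first-component-unique : ∀ {p₁ p₂ q₁ q₂} → W₁ p₁ → W₂ p₂ → W₁ q₁ → W₂ q₂ →
      p₁ ⊕ p₂ ≋ q₁ ⊕ q₂ → p₁ ≋ q₁
    first-component-unique p₁∈W₁ p₂∈W₂ q₁∈W₁ q₂∈W₂ eq = ⊖≋𝟎⇒≋ (W₁∩W₂≋𝟎 _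
      (⊖-∈ W₁-subspace tt p₁∈W₁ q₁∈W₁)
      (∈-resp W₂-subspace (≋-sym (⊕-transpose eq)) (⊖-∈ W₂-subspace tt q₂∈W₂ p₂∈W₂)))

  components-unique : ∀ {W₁ W₂ : V → Set} → IsFSubspace F k W₁ → IsFSubspace F k W₂ →
    (∀ v → W₁ v → W₂ v → v ≋ 𝟎) → ∀ {p₁ p₂ q₁ q₂} → W₁ p₁ → W₂ p₂ → W₁ q₁ → W₂ q₂ →
    p₁ ⊕ p₂ ≋ q₁ ⊕ q₂ → p₁ ≋ q₁ × p₂ ≋ q₂
  components-unique W₁-subspace W₂-subspace W₁∩W₂≋𝟎 p₁∈W₁ p₂∈W₂ q₁∈W₁ q₂∈W₂ eq =
    first-component-unique W₁-subspace W₂-subspace W₁∩W₂≋𝟎 p₁∈W₁ p₂∈W₂ q₁∈W₁ q₂∈W₂ eq ,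
    first-component-unique W₂-subspace W₁-subspace (λ v v∈W₂ v∈W₁ → W₁∩W₂≋𝟎 v v∈W₁ v∈W₂)
      p₂∈W₂ p₁∈W₁ q₂∈W₂ q₁∈W₁ (λ j → trans (+-comm _ _) (trans (eq j) (+-comm _ _)))

  HasDimK-cong : ∀ {K : Carrier → Set} {A B : V → Set} {n} →
    (∀ {x} → A x → B x) → (∀ {x} → B x → A x) → HasDimK F k K A n → HasDimK F k K B n
  HasDimK-cong A⊆B B⊆A (b , b∈A , independent , spanning) =
    b , A⊆B ∘ b∈A , independent , λ v → spanning v ∘ B⊆A

  module OverField (isField : IsField F) (_≟_ : Decidable _≈_) where

    •-cancelʳ : ∀ {a b v} → Nonzero F k v → a • v ≋ b • v → a ≈ b
    •-cancelʳ {a} {b} {v} v≢𝟎 av≋bv with (a - b) ≟ 0#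
    ... | yes a-b≈0 = x∙y⁻¹≈ε⇒x≈y a b a-b≈0
    ... | no a-b≉0 with proj₂ isField (a - b) a-b≉0
    ...   | e , [a-b]e≈1 = contradiction v≋𝟎 v≢𝟎
      where
      v≋𝟎 : v ≋ 𝟎
      v≋𝟎 j = x*y≈1⇒x*z≈0⇒z≈0 [a-b]e≈1
        (trans ([y-z]x≈yx-zx (v j) a b) (x≈y⇒x∙y⁻¹≈ε (av≋bv j)))

    coefficients∈K⇒weight-one : ∀ {K : Carrier → Set} {U : V → Set} {v} →
      (∀ {x y} → x ≋ y → U x → U y) → U v → Nonzero F k v →
      (∀ {a} → U (a • v) → K a) → HasWeight F k K U v 1
    coefficients∈K⇒weight-one {K} {U} {v} U-resp v∈U v≢𝟎 coefficient∈K =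
      (λ _ → v) , (λ _ → v∈U , 1# , ≋-sym (•-identityˡ v)) , independent , spanning
      where
      independent : KLinIndep F k K 1 (λ _ → v)
      independent c _ cv≋𝟎 zero = •-cancelʳ v≢𝟎
        (≋-trans (≋-sym (combination₁ c (λ _ → v))) (≋-trans cv≋𝟎 (≋-sym (≈0⇒•≋𝟎 v refl))))
      spanning : ∀ x → U x × FSpan F k v x → KCombination F k K 1 (λ _ → v) x
      spanning x (x∈U , a , x≋av) = (λ _ → a) , (λ _ → coefficient∈K (U-resp x≋av x∈U)) ,
        ≋-trans x≋av (≋-sym (combination₁ (λ _ → a) (λ _ → v)))

    module Subfield {K : Carrier → Set} (K-subfield : IsSubfield F K) where

      K-resp : ∀ {a b} → a ≈ b → K a → K b
      K-resp = let (resp , _) = K-subfield in resp _ _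

      K-* : ∀ {a b} → K a → K b → K (a * b)
      K-* = let (_ , _ , _ , _ , *-closed , _) = K-subfield in *-closed _ _

      K-inverse : ∀ {a} → K a → ¬ a ≈ 0# → ∃[ b ] (K b × a * b ≈ 1#)
      K-inverse = let (_ , _ , _ , _ , _ , _ , inverse) = K-subfield in inverse _

      same-K-line⇒coefficient∈K : ∀ {a c d β v} → Nonzero F k v → K c → K d →
        v ≋ c • β → a • v ≋ d • β → K a
      same-K-line⇒coefficient∈K {a} {c} {d} {β} {v} v≢𝟎 c∈K d∈K v≋cβ av≋dβ
        with K-inverse c∈K (λ c≈0 → v≢𝟎 (≋-trans v≋cβ (≈0⇒•≋𝟎 β c≈0)))
      ... | c' , c'∈K , cc'≈1 = K-resp (sym a≈dc') (K-* d∈K c'∈K)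
        where
        a≈dc' : a ≈ d * c'
        a≈dc' = •-cancelʳ v≢𝟎
          (≋-trans av≋dβ (≋-trans (•-congˡ d (•-invert cc'≈1 v≋cβ)) (•-assoc d c' v)))

      weight-one⇒coefficients∈K : ∀ {U : V → Set} {v} → U v → Nonzero F k v →
        HasWeight F k K U v 1 → ∀ {a} → U (a • v) → K a
      weight-one⇒coefficients∈K {v = v} v∈U v≢𝟎 (β , _ , _ , spanning) {a} av∈U
        with spanning v (v∈U , 1# , ≋-sym (•-identityˡ v)) | spanning (a • v) (av∈U , a , ≋-refl)
      ... | c , c∈K , v≋cβ | d , d∈K , av≋dβ =
        same-K-line⇒coefficient∈K v≢𝟎 (c∈K zero) (d∈K zero)
          (≋-trans v≋cβ (combination₁ c β)) (≋-trans av≋dβ (combination₁ d β))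

module DirectSum (F : CommutativeRing 0ℓ 0ℓ) (k : ℕ) (K : CommutativeRing.Carrier F → Set)
  {W₁ W₂ : Vec F k → Set} (W₁-subspace : IsFSubspace F k W₁) (W₂-subspace : IsFSubspace F k W₂)
  (W₁∩W₂≋𝟎 : ∀ v → W₁ v → W₂ v → _≈v_ F k v (0v F k))
  {U₁ U₂ : Vec F k → Set}
  (U₁-subspace : IsSubspaceOver F k K U₁) (U₂-subspace : IsSubspaceOver F k K U₂)
  (U₁⊆W₁ : _⊆v_ F k U₁ W₁) (U₂⊆W₂ : _⊆v_ F k U₂ W₂) where

  open CommutativeRing F hiding (zero)
  open Coordinates F k

  U : V → Set
  U = SumSpace F k U₁ U₂

  U-resp : ∀ {x y} → x ≋ y → U x → U y
  U-resp x≋y (u₁ , u₂ , u₁∈U₁ , u₂∈U₂ , x≋u₁⊕u₂) =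
    u₁ , u₂ , u₁∈U₁ , u₂∈U₂ , ≋-trans (≋-sym x≋y) x≋u₁⊕u₂

  U₁⊆U : ∀ {x} → U₁ x → U x
  U₁⊆U {x} x∈U₁ = x , 𝟎 , x∈U₁ , 𝟎-∈ U₂-subspace , ≋-sym (⊕-identityʳ x)

  U₂⊆U : ∀ {x} → U₂ x → U x
  U₂⊆U {x} x∈U₂ = 𝟎 , x , 𝟎-∈ U₁-subspace , x∈U₂ , λ j → sym (+-identityˡ (x j))

  U-components : ∀ {x p₁ p₂} → W₁ p₁ → W₂ p₂ → x ≋ p₁ ⊕ p₂ → U x → U₁ p₁ × U₂ p₂
  U-components p₁∈W₁ p₂∈W₂ x≋p₁⊕p₂ (u₁ , u₂ , u₁∈U₁ , u₂∈U₂ , x≋u₁⊕u₂)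
    with components-unique W₁-subspace W₂-subspace W₁∩W₂≋𝟎 p₁∈W₁ p₂∈W₂
           (U₁⊆W₁ u₁ u₁∈U₁) (U₂⊆W₂ u₂ u₂∈U₂) (≋-trans (≋-sym x≋p₁⊕p₂) x≋u₁⊕u₂)
  ... | p₁≋u₁ , p₂≋u₂ =
    ∈-resp U₁-subspace (≋-sym p₁≋u₁) u₁∈U₁ , ∈-resp U₂-subspace (≋-sym p₂≋u₂) u₂∈U₂

  U∩W₁⊆U₁ : ∀ {x} → W₁ x → U x → U₁ x
  U∩W₁⊆U₁ {x} x∈W₁ = proj₁ ∘ U-components x∈W₁ (𝟎-∈ W₂-subspace) (≋-sym (⊕-identityʳ x))

  HasDimK-U : ∀ {n₁ n₂} → HasDimK F k K U₁ n₁ → HasDimK F k K U₂ n₂ →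
    HasDimK F k K U (n₁ ℕ.+ n₂)
  HasDimK-U {n₁} {n₂} (b₁ , b₁∈U₁ , independent₁ , spanning₁)
                      (b₂ , b₂∈U₂ , independent₂ , spanning₂) =
    b₁ ++ b₂ , All.++⁺ U (U₁⊆U ∘ b₁∈U₁) (U₂⊆U ∘ b₂∈U₂) , independent , spanning
    where
    independent : KLinIndep F k K (n₁ ℕ.+ n₂) (b₁ ++ b₂)
    independent c c∈K cb≋𝟎 = ↑-elim n₁
      (independent₁ (take n₁ c) (c∈K ∘ (_↑ˡ n₂)) (proj₁ components≋𝟎))
      (independent₂ (drop n₁ c) (c∈K ∘ (n₁ ↑ʳ_)) (proj₂ components≋𝟎))
      where
      t₁∈W₁ : W₁ (combination (take n₁ c) b₁)
      t₁∈W₁ = U₁⊆W₁ _ (combination-∈ U₁-subspace n₁ (c∈K ∘ (_↑ˡ n₂)) b₁∈U₁)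
      t₂∈W₂ : W₂ (combination (drop n₁ c) b₂)
      t₂∈W₂ = U₂⊆W₂ _ (combination-∈ U₂-subspace n₂ (c∈K ∘ (n₁ ↑ʳ_)) b₂∈U₂)
      components≋𝟎 : combination (take n₁ c) b₁ ≋ 𝟎 × combination (drop n₁ c) b₂ ≋ 𝟎
      components≋𝟎 = components-unique W₁-subspace W₂-subspace W₁∩W₂≋𝟎
        t₁∈W₁ t₂∈W₂ (𝟎-∈ W₁-subspace) (𝟎-∈ W₂-subspace)
        (≋-trans (≋-sym (combination-++ c b₁ b₂)) (≋-trans cb≋𝟎 (≋-sym (⊕-identityʳ 𝟎))))
    spanning : ∀ v → U v → KCombination F k K (n₁ ℕ.+ n₂) (b₁ ++ b₂) v
    spanning v (u₁ , u₂ , u₁∈U₁ , u₂∈U₂ , v≋u₁⊕u₂)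
      with spanning₁ u₁ u₁∈U₁ | spanning₂ u₂ u₂∈U₂
    ... | c₁ , c₁∈K , u₁≋c₁b₁ | c₂ , c₂∈K , u₂≋c₂b₂ =
      c₁ ++ c₂ , All.++⁺ K c₁∈K c₂∈K ,
      ≋-trans v≋u₁⊕u₂
        (≋-trans (⊕-cong u₁≋c₁b₁ u₂≋c₂b₂) (≋-sym (combination-++-++ c₁ c₂ b₁ b₂)))

  HasWeight-U-W₁ : ∀ {v w} → W₁ v → HasWeight F k K U₁ v w → HasWeight F k K U v w
  HasWeight-U-W₁ v∈W₁ = HasDimK-cong {K = K}
    (λ (x∈U₁ , x∈⟨v⟩) → U₁⊆U x∈U₁ , x∈⟨v⟩)
    (λ (x∈U , a , x≋av) →
      U∩W₁⊆U₁ (∈-resp W₁-subspace (≋-sym x≋av) (•-∈ W₁-subspace tt v∈W₁)) x∈U , a , x≋av)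

  module _ (isField : IsField F) (_≟_ : Decidable _≈_) (K-subfield : IsSubfield F K) where
    open OverField isField _≟_
    open Subfield K-subfield

    scaled-components : ∀ {a x x₁ x₂} → U₁ x₁ → U₂ x₂ → x ≋ x₁ ⊕ x₂ → U (a • x) →
      U₁ (a • x₁) × U₂ (a • x₂)
    scaled-components {a} x₁∈U₁ x₂∈U₂ x≋x₁⊕x₂ = U-components
      (•-∈ W₁-subspace tt (U₁⊆W₁ _ x₁∈U₁)) (•-∈ W₂-subspace tt (U₂⊆W₂ _ x₂∈U₂))
      (≋-trans (•-congˡ a x≋x₁⊕x₂) (•-distribˡ a _ _))

    IsClub-U : ∀ {i} → IsClub F k K U₁ i → IsScattered F k K U₂ → IsClub F k K U i
    IsClub-U (u , u∈U₁ , u≢𝟎 , u-weight , weight-one₁) U₂-scattered =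
      u , U₁⊆U u∈U₁ , u≢𝟎 , HasWeight-U-W₁ (U₁⊆W₁ u u∈U₁) u-weight , weight-one
      where
      weight-one : ∀ x → U x → Nonzero F k x → ¬ FSpan F k u x → HasWeight F k K U x 1
      weight-one x x∈U@(x₁ , x₂ , x₁∈U₁ , x₂∈U₂ , x≋x₁⊕x₂) x≢𝟎 x∉⟨u⟩ =
        coefficients∈K⇒weight-one U-resp x∈U x≢𝟎 coefficient∈K
        where
        coefficient∈K : ∀ {a} → U (a • x) → K a
        coefficient∈K ax∈U with scaled-components x₁∈U₁ x₂∈U₂ x≋x₁⊕x₂ ax∈U
                              | Fin.all? (λ j → x₂ j ≟ 0#)
        ... | _ , ax₂∈U₂ | no x₂≢𝟎 = weight-one⇒coefficients∈K x₂∈U₂ x₂≢𝟎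
          (U₂-scattered x₂ x₂∈U₂ x₂≢𝟎) ax₂∈U₂
        ... | ax₁∈U₁ , _ | yes x₂≋𝟎 = weight-one⇒coefficients∈K x₁∈U₁ x₁≢𝟎
          (weight-one₁ x₁ x₁∈U₁ x₁≢𝟎 x₁∉⟨u⟩) ax₁∈U₁
          where
          x≋x₁ : x ≋ x₁
          x≋x₁ = ≋-trans x≋x₁⊕x₂ (≋-trans (⊕-cong ≋-refl x₂≋𝟎) (⊕-identityʳ x₁))
          x₁≢𝟎 : Nonzero F k x₁
          x₁≢𝟎 = x≢𝟎 ∘ ≋-trans x≋x₁
          x₁∉⟨u⟩ : ¬ FSpan F k u x₁
          x₁∉⟨u⟩ (a , x₁≋au) = x∉⟨u⟩ (a , ≋-trans x≋x₁ x₁≋au)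

open import Data.Nat using (_+_)

lemma3p2 : (q m k : ℕ) → IsPrimePower q → 1 ≤ k → 1 ≤ m →
    (F : CommutativeRing 0ℓ 0ℓ) → IsField F → HasCard F (q ^ m) →
    (K : CommutativeRing.Carrier F → Set) → IsSubfield F K → SubsetHasCard F K q →
    (W₁ W₂ : Vec F k → Set) → IsFSubspace F k W₁ → IsFSubspace F k W₂ →
    DirectSumWhole F k W₁ W₂ →
    (U₁ U₂ : Vec F k → Set) → IsSubspaceOver F k K U₁ → IsSubspaceOver F k K U₂ →
    _⊆v_ F k U₁ W₁ → _⊆v_ F k U₂ W₂ →
    (n₁ n₂ i : ℕ) → HasDimK F k K U₁ n₁ → HasDimK F k K U₂ n₂ →
    IsClub F k K U₁ i → IsScattered F k K U₂ →
    HasDimK F k K (SumSpace F k U₁ U₂) (n₁ + n₂) × IsClub F k K (SumSpace F k U₁ U₂) i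
lemma3p2 _ _ k _ _ _ F isField card K K-subfield _ _ _ W₁-subspace W₂-subspace (W₁∩W₂≋𝟎 , _)
         _ _ U₁-subspace U₂-subspace U₁⊆W₁ U₂⊆W₂ _ _ _ dim₁ dim₂ club scattered =
  -- Finiteness of F is only used to decide equality; q, m, k and |K| play no further role.
  HasDimK-U dim₁ dim₂ ,
  IsClub-U isField (HasCard⇒≈-decidable F card) K-subfield club scattered
  where
  open DirectSum F k K W₁-subspace W₂-subspace W₁∩W₂≋𝟎 U₁-subspace U₂-subspace U₁⊆W₁ U₂⊆W₂
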